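{- Let $n\ge 3$ be an odd integer and $\mathrm{D}_{2n}=\langle a,b\mid a^n=b^2=1,\ abab=1\rangle$. Then $\Gamma=\mathrm{Cay}(\mathrm{D}_{2n},\{a,a^{ -1},a^2b,b\})$ is a connected CI-graph, but $\Gamma$ is not normal with respect to $\mathrm{D}_{2n}$.
   Context: For a finite group $G$ and $S\subseteq G\setminus\{1\}$, $\mathrm{Cay}(G,S)$ is the digraph with vertex set $G$ and arcs $(x,y)$ with $yx^{ -1}\in S$; a graph when $S=S^{ -1}$. It is a CI-graph if for every $T\subseteq G\setminus\{1\}$ with $\mathrm{Cay}(G,S)\cong\mathrm{Cay}(G,T)$ there is $\sigma\in\mathrm{Aut}(G)$ with $S^\sigma=T$. For $g\in G$, $R(g)$ is the right multiplication $x\mapsto xg$, and $R(G)=\{R(g)\mid g\in G\}\le\mathrm{Aut}(\mathrm{Cay}(G,S))$. The Cayley digraph is normal with respect to $G$ if $R(G)$ is a normal subgroup of $\mathrm{Aut}(\mathrm{Cay}(G,S))$. -}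

module Defs where

open import Data.Nat using (ℕ; zero; suc; _+_; _*_; _∸_; NonZero)
open import Data.Nat.DivMod using (_mod_)
open import Data.Fin using (Fin; toℕ)
import Data.Fin.Properties as FinP
open import Data.Bool using (Bool; true; false; not; _∨_)
import Data.Bool.Properties as BoolP
open import Data.Product using (Σ; ∃; _×_; _,_; proj₁; proj₂)
open import Data.Product.Properties using (≡-dec)
open import Data.List using (List; []; _∷_)
open import Data.Bool.ListAction using (any)
open import Relation.Nullary using (does)
open import Relation.Binary.PropositionalEquality using (_≡_)
open import Relation.Binary.Construct.Closure.ReflexiveTransitive using (Star)
open import Function.Bundles using (_↔_; Inverse)

record GroupOn (G : Set) : Set where
  field
    _·_ : G → G → G
    one : G
    inv : G → G

Subset : Set → Set
Subset G = G → Bool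

module _ {G : Set} (𝔾 : GroupOn G) where
  open GroupOn 𝔾

  Arc : Subset G → G → G → Set
  Arc S x y = S (y · inv x) ≡ true

  IsGroupAut : G ↔ G → Set
  IsGroupAut σ = ∀ x y → Inverse.to σ (x · y) ≡ Inverse.to σ x · Inverse.to σ y

  IsCayIso : Subset G → Subset G → G ↔ G → Set
  IsCayIso S T φ = ∀ x y →
    S (y · inv x) ≡ T (Inverse.to φ y · inv (Inverse.to φ x))

  CayIsomorphic : Subset G → Subset G → Set
  CayIsomorphic S T = Σ (G ↔ G) (IsCayIso S T)

  IsCI : Subset G → Set
  IsCI S = (T : Subset G) → T one ≡ false → CayIsomorphic S T →
    Σ (G ↔ G) λ σ → IsGroupAut σ × (∀ x → T (Inverse.to σ x) ≡ S x)

  Connected : Subset G → Set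
  Connected S = ∀ x y → Star (Arc S) x y

  -- right regular representation R(g) : x ↦ x g
  -- normality: R(G) ⊴ Aut(Cay(G,S)), i.e. φ R(g) φ⁻¹ ∈ R(G)
  -- for every automorphism φ of the digraph and every g ∈ G
  IsNormalCayley : Subset G → Set
  IsNormalCayley S = (φ : G ↔ G) → IsCayIso S S φ → (g : G) →
    ∃ λ h → ∀ x → Inverse.to φ (Inverse.from φ x · g) ≡ x · h

-- Dihedral group D_{2n}: element (i , e) stands for a^i b^e

Dih : ℕ → Set
Dih n = Fin n × Bool

module _ (n : ℕ) .{{_ : NonZero n}} where

  addₙ : Fin n → Fin n → Fin n
  addₙ i j = (toℕ i + toℕ j) mod n

  negₙ : Fin n → Fin n
  negₙ i = (n ∸ toℕ i) mod n

  -- b a^j = a^{-j} b  (from abab = 1, b² = 1)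
  dihMul : Dih n → Dih n → Dih n
  dihMul (i , false) (j , f) = addₙ i j , f
  dihMul (i , true)  (j , f) = addₙ i (negₙ j) , not f

  dihInv : Dih n → Dih n
  dihInv (i , false) = negₙ i , false
  dihInv (i , true)  = i , true

  D : GroupOn (Dih n)
  D = record { _·_ = dihMul ; one = (0 mod n) , false ; inv = dihInv }

  a a⁻¹ b a²b : Dih n
  a   = (1 mod n) , false
  a⁻¹ = dihInv a
  b   = (0 mod n) , true
  a²b = (2 mod n) , true

  _≟D_ : (x y : Dih n) → _
  _≟D_ = ≡-dec FinP._≟_ BoolP._≟_

  listSubset : List (Dih n) → Subset (Dih n)
  listSubset xs x = any (λ s → does (x ≟D s)) xs

  S₀ : Subset (Dih n)
  S₀ = listSubset (a ∷ a⁻¹ ∷ a²b ∷ b ∷ [])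

Odd : ℕ → Set
Odd n = ∃ λ k → n ≡ suc (2 * k)

-- The vertices 1 and ab of Γ have the same neighbours (S·ab = S), and they are the
-- only such pair containing 1.  Exchanging them is an automorphism of Γ that does not normalise the
-- right regular representation, so Γ is not normal.  For the CI property, translate a given
-- isomorphism Γ ≅ Cay(D₂ₙ,T) so that it fixes 1; then T is the image of S, is inverse-closed, and the
-- image g of ab is the unique nontrivial twin of 1, hence an involution, hence (n odd) a reflection.
-- T contains a rotation ρ = aⁱ, so the four distinct elements ρ, ρ⁻¹, ρg, ρ⁻¹g exhaust T.  As
-- Cay(D₂ₙ,T) is connected, T generates D₂ₙ, which forces i to be a unit modulo n, and then
-- a ↦ ρ, ab ↦ g extends to an automorphism of D₂ₙ mapping S onto T.
module Submission where

open import Defs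
open import Data.Nat using (ℕ; _≤_; NonZero)
open import Data.Product using (_×_)
open import Relation.Nullary using (¬_)

open import Algebra.Bundles using (Group)
import Algebra.Properties.Group as GroupProperties
open import Algebra.Structures using (IsGroup)
open import Data.Bool using (Bool; true; false; not)
open import Data.Empty using (⊥-elim)
open import Data.Fin using (Fin; toℕ; fromℕ<) renaming (zero to fzero; suc to fsuc)
import Data.Fin.Properties as Finₚ
open import Data.Integer using (ℤ; +_; _+_; _*_; -_; _-_; ∣_∣)
open import Data.Integer.Base using (_%ℕ_; _/ℕ_)
open import Data.Integer.DivMod using (n%ℕd<d; a≡a%ℕn+[a/ℕn]*n)
open import Data.Integer.Divisibility.Signed
  using (_∣_; divides; ∣⇒∣ᵤ; ∣m∣n⇒∣m+n; ∣m⇒∣-m; ∣m⇒∣m*n; ∣n⇒∣m*n)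
import Data.Integer.Properties as ℤₚ
open import Data.Integer.Tactic.RingSolver using (solve-∀)
open import Data.List using (List; []; _∷_; length; lookup; map)
open import Data.List.Membership.Propositional using (_∈_)
open import Data.List.Membership.Propositional.Properties using (∈-lookup; ∈-map⁺; ∈-map⁻)
import Data.List.Membership.DecPropositional as DecMembership
open import Data.List.Relation.Unary.All as All using (All; []; _∷_)
open import Data.List.Relation.Unary.All.Properties using (¬Any⇒All¬)
open import Data.List.Relation.Unary.AllPairs using ([]; _∷_)
open import Data.List.Relation.Unary.Any using (here; there; index)
open import Data.List.Relation.Unary.Any.Properties using (lookup-index)
open import Data.List.Relation.Unary.Unique.Propositional using (Unique)
import Data.Nat as ℕ
open import Data.Nat.Divisibility using (∣⇒≤) renaming (_∣_ to _∣ℕ_)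
open import Data.Nat.DivMod using (_mod_)
import Data.Nat.Properties as ℕₚ
open import Data.Product using (Σ; _,_; proj₁; proj₂)
open import Data.Sum as Sum using (_⊎_; inj₁; inj₂)
open import Function.Base using (id; case_of_)
open import Function.Bundles using (_↔_; Inverse; Injection; mk↔ₛ′)
open import Function.Construct.Composition using (_↔-∘_)
open import Function.Properties.Inverse using (↔-sym; ↔⇒↣)
open import Relation.Binary.Bundles using (Setoid)
open import Relation.Binary.Construct.Closure.ReflexiveTransitive using (Star; ε; _◅_; _◅◅_; gmap)
open import Relation.Binary.Definitions using (DecidableEquality)
open import Relation.Binary.PropositionalEquality
import Relation.Binary.Reasoning.Setoid as SetoidReasoning
open import Relation.Nullary using (yes; no)

module _ {A : Set} where

  Unique⇒lookup-injective : ∀ {xs : List A} → Unique xs → ∀ {i j} → lookup xs i ≡ lookup xs j → i ≡ j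
  Unique⇒lookup-injective (_ ∷ _)    {fzero}  {fzero}  _  = refl
  Unique⇒lookup-injective (x∉ ∷ _)   {fzero}  {fsuc j} eq = ⊥-elim (All.lookup x∉ (∈-lookup j) eq)
  Unique⇒lookup-injective (x∉ ∷ _)   {fsuc i} {fzero}  eq = ⊥-elim (All.lookup x∉ (∈-lookup i) (sym eq))
  Unique⇒lookup-injective (_ ∷ uniq) {fsuc i} {fsuc j} eq = cong fsuc (Unique⇒lookup-injective uniq eq)

  Unique-⊆⇒length≤ : ∀ {xs ys : List A} → Unique ys → (∀ {z} → z ∈ ys → z ∈ xs) →
                     length ys ≤ length xs
  Unique-⊆⇒length≤ {xs} {ys} uniq ys⊆xs = ℕₚ.≮⇒≥ λ xs<ys →
    let (i , j , i<j , same-index) = Finₚ.pigeonhole xs<ys position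
    in Finₚ.<-irrefl (Unique⇒lookup-injective uniq (begin
         lookup ys i                ≡⟨ lookup-index (ys⊆xs (∈-lookup i)) ⟩
         lookup xs (position i)     ≡⟨ cong (lookup xs) same-index ⟩
         lookup xs (position j)     ≡⟨ lookup-index (ys⊆xs (∈-lookup j)) ⟨
         lookup ys j                ∎)) i<j
    where
    open ≡-Reasoning
    position : Fin (length ys) → Fin (length xs)
    position i = index (ys⊆xs (∈-lookup i))

  module _ (_≟_ : DecidableEquality A) where
    open DecMembership _≟_ using (_∈?_)

    Unique-covers : ∀ {P : A → Set} {xs ys : List A} → Unique ys → length xs ≤ length ys →
                    (∀ {z} → P z → z ∈ xs) → All P ys → ∀ {z} → P z → z ∈ ys
    Unique-covers {xs = xs} {ys} uniq xs≤ys cover Pys {z} Pz with z ∈? ys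
    ... | yes z∈ys = z∈ys
    ... | no  z∉ys = ⊥-elim (ℕₚ.n≮n _ (ℕₚ.≤-trans z∷ys≤xs xs≤ys))
      where
      z∷ys⊆xs : ∀ {w} → w ∈ z ∷ ys → w ∈ xs
      z∷ys⊆xs (here refl)  = cover Pz
      z∷ys⊆xs (there w∈ys) = cover (All.lookup Pys w∈ys)
      z∷ys≤xs : length (z ∷ ys) ≤ length xs
      z∷ys≤xs = Unique-⊆⇒length≤ (¬Any⇒All¬ ys z∉ys ∷ uniq) z∷ys⊆xs

≡true⇔⇒≡ : ∀ {p q : Bool} → (p ≡ true → q ≡ true) → (q ≡ true → p ≡ true) → p ≡ q
≡true⇔⇒≡ {false} {false} _   _   = refl
≡true⇔⇒≡ {false} {true}  _   q⇒p = q⇒p refl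
≡true⇔⇒≡ {true}  {false} p⇒q _   = sym (p⇒q refl)
≡true⇔⇒≡ {true}  {true}  _   _   = refl

involution-invariant : ∀ {A : Set} (P : A → Bool) (f : A → A) → (∀ x → f (f x) ≡ x) →
                       (∀ x → P x ≡ true → P (f x) ≡ true) → ∀ x → P (f x) ≡ P x
involution-invariant P f f∘f≡id closed x =
  ≡true⇔⇒≡ (λ Pfx → subst (λ y → P y ≡ true) (f∘f≡id x) (closed (f x) Pfx)) (closed x)

IsGroupOn : {G : Set} → GroupOn G → Set
IsGroupOn 𝔾 = IsGroup _≡_ _·_ one inv
  where open GroupOn 𝔾

module _ {H G : Set} {_∙_ : H → H → H} {e : H} {_⁻¹ : H → H}
         (H-isGroup : IsGroup _≡_ _∙_ e _⁻¹) (𝔾 : GroupOn G) where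

  open GroupOn 𝔾
  private
    module H = IsGroup H-isGroup

  surjective-image-isGroup : (π : H → G) (section : G → H) → (∀ x → π (section x) ≡ x) →
                             (∀ u v → π (u ∙ v) ≡ π u · π v) → π e ≡ one →
                             (∀ u → π (u ⁻¹) ≡ inv (π u)) → IsGroupOn 𝔾
  surjective-image-isGroup π section π-section π-∙ π-e π-⁻¹ = record
    { isMonoid = record
      { isSemigroup = record
        { isMagma = record { isEquivalence = isEquivalence ; ∙-cong = cong₂ _·_ }
        ; assoc = assoc }
      ; identity = identityˡ , identityʳ }
    ; inverse = inverseˡ , inverseʳ
    ; ⁻¹-cong = cong inv }
    where
    open ≡-Reasoning

    on-image : (P : G → Set) → (∀ u → P (π u)) → ∀ x → P x
    on-image P P-π x = subst P (π-section x) (P-π (section x))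

    assoc : ∀ x y z → (x · y) · z ≡ x · (y · z)
    assoc x y z = begin
      (x · y) · z          ≡⟨ cong₂ _·_ (cong₂ _·_ (π-section x) (π-section y)) (π-section z) ⟨
      (π X · π Y) · π Z    ≡⟨ cong (_· π Z) (π-∙ X Y) ⟨
      π (X ∙ Y) · π Z      ≡⟨ π-∙ (X ∙ Y) Z ⟨
      π ((X ∙ Y) ∙ Z)      ≡⟨ cong π (H.assoc X Y Z) ⟩
      π (X ∙ (Y ∙ Z))      ≡⟨ π-∙ X (Y ∙ Z) ⟩
      π X · π (Y ∙ Z)      ≡⟨ cong (π X ·_) (π-∙ Y Z) ⟩
      π X · (π Y · π Z)    ≡⟨ cong₂ _·_ (π-section x) (cong₂ _·_ (π-section y) (π-section z)) ⟩
      x · (y · z)          ∎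
      where
      X Y Z : H
      X = section x
      Y = section y
      Z = section z

    identityˡ : ∀ x → one · x ≡ x
    identityˡ = on-image (λ x → one · x ≡ x) λ u → begin
      one · π u    ≡⟨ cong (_· π u) π-e ⟨
      π e · π u    ≡⟨ π-∙ e u ⟨
      π (e ∙ u)    ≡⟨ cong π (H.identityˡ u) ⟩
      π u          ∎

    identityʳ : ∀ x → x · one ≡ x
    identityʳ = on-image (λ x → x · one ≡ x) λ u → begin
      π u · one    ≡⟨ cong (π u ·_) π-e ⟨
      π u · π e    ≡⟨ π-∙ u e ⟨
      π (u ∙ e)    ≡⟨ cong π (H.identityʳ u) ⟩
      π u          ∎

    inverseˡ : ∀ x → inv x · x ≡ one
    inverseˡ = on-image (λ x → inv x · x ≡ one) λ u → begin
      inv (π u) · π u    ≡⟨ cong (_· π u) (π-⁻¹ u) ⟨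
      π (u ⁻¹) · π u     ≡⟨ π-∙ (u ⁻¹) u ⟨
      π ((u ⁻¹) ∙ u)     ≡⟨ cong π (H.inverseˡ u) ⟩
      π e                ≡⟨ π-e ⟩
      one                ∎

    inverseʳ : ∀ x → x · inv x ≡ one
    inverseʳ = on-image (λ x → x · inv x ≡ one) λ u → begin
      π u · inv (π u)    ≡⟨ cong (π u ·_) (π-⁻¹ u) ⟨
      π u · π (u ⁻¹)     ≡⟨ π-∙ u (u ⁻¹) ⟨
      π (u ∙ (u ⁻¹))     ≡⟨ cong π (H.inverseʳ u) ⟩
      π e                ≡⟨ π-e ⟩
      one                ∎

module CayleyDigraph {G : Set} (𝔾 : GroupOn G) (isGroup : IsGroupOn 𝔾) where

  open GroupOn 𝔾
  open IsGroup isGroup using (assoc; identityˡ; identityʳ; inverseˡ; inverseʳ)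

  group : Group _ _
  group = record { isGroup = isGroup }

  open GroupProperties group
    using (ε⁻¹≈ε; ⁻¹-involutive; ⁻¹-anti-homo-∙; //-rightDividesˡ; //-rightDividesʳ;
           ∙-cancelˡ; identityˡ-unique; identityʳ-unique; inverseˡ-unique)
  open ≡-Reasoning

  Symmetric : Subset G → Set
  Symmetric S = ∀ x → S (inv x) ≡ S x

  record Twins (S : Subset G) (x y : G) : Set where
    constructor twins
    field same-out-neighbours : ∀ w → S (w · inv x) ≡ S (w · inv y)
  open Twins

  ·inv-one : ∀ x → x · inv one ≡ x
  ·inv-one x = trans (cong (x ·_) ε⁻¹≈ε) (identityʳ x)

  inv-quotient : ∀ x y → inv (y · inv x) ≡ x · inv y
  inv-quotient x y = trans (⁻¹-anti-homo-∙ y (inv x)) (cong (_· inv y) (⁻¹-involutive x))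

  quotient-right-invariant : ∀ g x y → (y · g) · inv (x · g) ≡ y · inv x
  quotient-right-invariant g x y = begin
    (y · g) · inv (x · g)       ≡⟨ cong ((y · g) ·_) (⁻¹-anti-homo-∙ x g) ⟩
    (y · g) · (inv g · inv x)   ≡⟨ assoc (y · g) (inv g) (inv x) ⟨
    ((y · g) · inv g) · inv x   ≡⟨ cong (_· inv x) (//-rightDividesʳ g y) ⟩
    y · inv x                   ∎

  module _ {f : G → G} (f-· : ∀ x y → f (x · y) ≡ f x · f y) where

    homomorphism-one : f one ≡ one
    homomorphism-one = identityʳ-unique (f one) (f one) (trans (sym (f-· one one)) (cong f (identityˡ one)))

    homomorphism-inv : ∀ x → f (inv x) ≡ inv (f x)
    homomorphism-inv x = inverseˡ-unique (f (inv x)) (f x)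
      (trans (sym (f-· (inv x) x)) (trans (cong f (inverseˡ x)) homomorphism-one))

  module _ {S : Subset G} where

    arc-right : ∀ g {x y} → Arc 𝔾 S x y → Arc 𝔾 S (x · g) (y · g)
    arc-right g {x} {y} xy = trans (cong S (quotient-right-invariant g x y)) xy

    arc-left : ∀ x s → S s ≡ true → Arc 𝔾 S x (s · x)
    arc-left x s s∈S = trans (cong S (//-rightDividesʳ x s)) s∈S

    connected-from-one : (∀ z → Star (Arc 𝔾 S) one z) → Connected 𝔾 S
    connected-from-one reach x y =
      subst₂ (Star (Arc 𝔾 S)) (identityˡ x) (//-rightDividesˡ x y)
        (gmap (_· x) (arc-right x) (reach (y · inv x)))

    Twins-one⁺ : ∀ {t} → (∀ w → S (w · inv t) ≡ S w) → Twins S one t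
    Twins-one⁺ h = twins λ w → trans (cong S (·inv-one w)) (sym (h w))

    Twins-one⁻ : ∀ {t} → Twins S one t → ∀ w → S (w · inv t) ≡ S w
    Twins-one⁻ tw w = trans (sym (same-out-neighbours tw w)) (cong S (·inv-one w))

    Twins-one-· : ∀ {x y} → Twins S one x → Twins S one y → Twins S one (x · y)
    Twins-one-· {x} {y} tx ty = Twins-one⁺ λ w → begin
      S (w · inv (x · y))         ≡⟨ cong (λ u → S (w · u)) (⁻¹-anti-homo-∙ x y) ⟩
      S (w · (inv y · inv x))     ≡⟨ cong S (assoc w (inv y) (inv x)) ⟨
      S ((w · inv y) · inv x)     ≡⟨ Twins-one⁻ tx (w · inv y) ⟩
      S (w · inv y)               ≡⟨ Twins-one⁻ ty w ⟩
      S w                         ∎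

    Twins⇒same-in-neighbours : Symmetric S → ∀ {x y} → Twins S x y →
                               ∀ w → S (x · inv w) ≡ S (y · inv w)
    Twins⇒same-in-neighbours sym-S {x} {y} tw w = begin
      S (x · inv w)         ≡⟨ cong S (inv-quotient x w) ⟨
      S (inv (w · inv x))   ≡⟨ sym-S (w · inv x) ⟩
      S (w · inv x)         ≡⟨ same-out-neighbours tw w ⟩
      S (w · inv y)         ≡⟨ sym-S (w · inv y) ⟨
      S (inv (w · inv y))   ≡⟨ cong S (inv-quotient y w) ⟩
      S (y · inv w)         ∎

    twin-permutation-IsCayIso : Symmetric S → (φ : G ↔ G) → (∀ x → Twins S x (Inverse.to φ x)) →
                                IsCayIso 𝔾 S S φ
    twin-permutation-IsCayIso sym-S φ tw x y =
      trans (same-out-neighbours (tw x) y) (Twins⇒same-in-neighbours sym-S (tw y) (Inverse.to φ x))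

    connected⇒generated : Connected 𝔾 S → {P : G → Set} → P one →
                          (∀ {s x} → S s ≡ true → P x → P (s · x)) → ∀ x → P x
    connected⇒generated conn {P} P-one P-step x = go (conn one x) P-one
      where
      go : ∀ {u w} → Star (Arc 𝔾 S) u w → P u → P w
      go ε Pu = Pu
      go {u} (_◅_ {j = v} uv vw) Pu = go vw (subst P (//-rightDividesˡ u v) (P-step uv Pu))

  rightTranslation : G → G ↔ G
  rightTranslation g = mk↔ₛ′ (_· g) (_· inv g) (//-rightDividesˡ g) (//-rightDividesʳ g)

  IsCayIso-rightTranslation : ∀ S g → IsCayIso 𝔾 S S (rightTranslation g)
  IsCayIso-rightTranslation S g x y = cong S (sym (quotient-right-invariant g x y))

  IsCayIso-∘ : ∀ {S T U φ χ} → IsCayIso 𝔾 S T φ → IsCayIso 𝔾 T U χ → IsCayIso 𝔾 S U (χ ↔-∘ φ)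
  IsCayIso-∘ {φ = φ} φ-iso χ-iso x y = trans (φ-iso x y) (χ-iso (Inverse.to φ x) (Inverse.to φ y))

  CayIsomorphic-fixing-one : ∀ {S T} → CayIsomorphic 𝔾 S T →
              Σ (G ↔ G) λ ψ → IsCayIso 𝔾 S T ψ × Inverse.to ψ one ≡ one
  CayIsomorphic-fixing-one {S} {T} (φ , φ-iso) =
    translate ↔-∘ φ ,
    IsCayIso-∘ {S} {T} {T} {φ} {translate} φ-iso (IsCayIso-rightTranslation T (inv (to one))) ,
    inverseʳ (to one)
    where
    open Inverse φ using (to)
    translate : G ↔ G
    translate = rightTranslation (inv (to one))

  module Isomorphism {S T : Subset G} {ψ : G ↔ G} (ψ-iso : IsCayIso 𝔾 S T ψ) where
    open Inverse ψ using (to; from; strictlyInverseˡ; strictlyInverseʳ)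

    IsCayIso-sym : IsCayIso 𝔾 T S (↔-sym ψ)
    IsCayIso-sym x y = sym (begin
      S (from y · inv (from x))             ≡⟨ ψ-iso (from x) (from y) ⟩
      T (to (from y) · inv (to (from x)))   ≡⟨ cong₂ (λ u v → T (u · inv v))
                                                     (strictlyInverseˡ y) (strictlyInverseˡ x) ⟩
      T (y · inv x)                         ∎)

    Twins-transport : ∀ {x y} → Twins S x y → Twins T (to x) (to y)
    Twins-transport {x} {y} tw = twins λ w → begin
      T (w · inv (to x))             ≡⟨ cong (λ u → T (u · inv (to x))) (strictlyInverseˡ w) ⟨
      T (to (from w) · inv (to x))   ≡⟨ ψ-iso x (from w) ⟨
      S (from w · inv x)             ≡⟨ same-out-neighbours tw (from w) ⟩
      S (from w · inv y)             ≡⟨ ψ-iso y (from w) ⟩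
      T (to (from w) · inv (to y))   ≡⟨ cong (λ u → T (u · inv (to y))) (strictlyInverseˡ w) ⟩
      T (w · inv (to y))             ∎

    Connected-transport : Connected 𝔾 S → Connected 𝔾 T
    Connected-transport conn x y =
      subst₂ (Star (Arc 𝔾 T)) (strictlyInverseˡ x) (strictlyInverseˡ y)
        (gmap to (λ {u} {v} uv → trans (sym (ψ-iso u v)) uv) (conn (from x) (from y)))

    module _ (ψ-one : to one ≡ one) where

      ψ⁻¹-one : from one ≡ one
      ψ⁻¹-one = trans (cong from (sym ψ-one)) (strictlyInverseʳ one)

      Twins-one-transport : ∀ {y} → Twins S one y → Twins T one (to y)
      Twins-one-transport {y} tw = subst (λ u → Twins T u (to y)) ψ-one (Twins-transport tw)

      connection-set-image : ∀ x → T (to x) ≡ S x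
      connection-set-image x = begin
        T (to x)                ≡⟨ cong T (·inv-one (to x)) ⟨
        T (to x · inv one)      ≡⟨ cong (λ u → T (to x · inv u)) ψ-one ⟨
        T (to x · inv (to one)) ≡⟨ ψ-iso one x ⟨
        S (x · inv one)         ≡⟨ cong S (·inv-one x) ⟩
        S x                     ∎

      Symmetric-transport : Symmetric S → Symmetric T
      Symmetric-transport sym-S z = begin
        T (inv z)                   ≡⟨ cong (λ u → T (inv u)) (strictlyInverseˡ z) ⟨
        T (inv (to x))              ≡⟨ cong T (identityˡ (inv (to x))) ⟨
        T (one · inv (to x))        ≡⟨ cong (λ u → T (u · inv (to x))) ψ-one ⟨
        T (to one · inv (to x))     ≡⟨ ψ-iso x one ⟨
        S (one · inv x)             ≡⟨ cong S (identityˡ (inv x)) ⟩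
        S (inv x)                   ≡⟨ sym-S x ⟩
        S x                         ≡⟨ connection-set-image x ⟨
        T (to x)                    ≡⟨ cong T (strictlyInverseˡ z) ⟩
        T z                         ∎
        where
        x : G
        x = from z

  module Transposition (_≟_ : DecidableEquality G) where

    transpose : G → G → G → G
    transpose x y z with z ≟ x | z ≟ y
    ... | yes _ | _     = y
    ... | no  _ | yes _ = x
    ... | no  _ | no  _ = z

    transpose-fixes : ∀ {x y z} → z ≢ x → z ≢ y → transpose x y z ≡ z
    transpose-fixes {x} {y} {z} z≢x z≢y with z ≟ x | z ≟ y
    ... | yes z≡x | _       = ⊥-elim (z≢x z≡x)
    ... | no  _   | yes z≡y = ⊥-elim (z≢y z≡y)
    ... | no  _   | no  _   = refl

    transpose-x : ∀ x y → transpose x y x ≡ y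
    transpose-x x y with x ≟ x
    ... | yes _   = refl
    ... | no  x≢x = ⊥-elim (x≢x refl)

    transpose-y : ∀ x y → transpose x y y ≡ x
    transpose-y x y with y ≟ x | y ≟ y
    ... | yes y≡x | _       = y≡x
    ... | no  _   | yes _   = refl
    ... | no  _   | no  y≢y = ⊥-elim (y≢y refl)

    transpose-involutive : ∀ x y z → transpose x y (transpose x y z) ≡ z
    transpose-involutive x y z with z ≟ x | z ≟ y
    ... | yes refl | _        = transpose-y z y
    ... | no  _    | yes refl = transpose-x x z
    ... | no  z≢x  | no  z≢y  = transpose-fixes z≢x z≢y

    transposition : G → G → G ↔ G
    transposition x y =
      mk↔ₛ′ (transpose x y) (transpose x y) (transpose-involutive x y) (transpose-involutive x y)

    module _ {S : Subset G} (sym-S : Symmetric S) where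

      transposition-IsCayIso : ∀ {x y} → Twins S x y → IsCayIso 𝔾 S S (transposition x y)
      transposition-IsCayIso {x} {y} tw = twin-permutation-IsCayIso sym-S (transposition x y) twin-image
        where
        twin-image : ∀ z → Twins S z (transpose x y z)
        twin-image z with z ≟ x | z ≟ y
        ... | yes refl | _        = tw
        ... | no  _    | yes refl = twins λ w → sym (same-out-neighbours tw w)
        ... | no  _    | no  _    = twins λ _ → refl

      -- If φ = (1 t) normalised R(G), then φ R(g) φ⁻¹ = R(h) would force h = g (compare at t·g)
      -- and then t·g = g (compare at 1).
      transposition-not-normal : ∀ {t} → Twins S one t → t ≢ one → ∀ g →
                                 t · g ≢ one → t · g ≢ t → (t · g) · g ≢ one → (t · g) · g ≢ t →
                                 ¬ IsNormalCayley 𝔾 S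
      transposition-not-normal {t} tw t≢one g tg≢one tg≢t tgg≢one tgg≢t normal =
        t≢one (identityˡ-unique t g t·g≡g)
        where
        fix₁ : transpose one t (t · g) ≡ t · g
        fix₁ = transpose-fixes tg≢one tg≢t
        fix₂ : transpose one t ((t · g) · g) ≡ (t · g) · g
        fix₂ = transpose-fixes tgg≢one tgg≢t
        τ : G → G
        τ = transpose one t
        conjugate : Σ G λ h → ∀ x → τ (τ x · g) ≡ x · h
        conjugate = normal (transposition one t) (transposition-IsCayIso tw) g
        h : G
        h = proj₁ conjugate
        τ-conj : ∀ x → τ (τ x · g) ≡ x · h
        τ-conj = proj₂ conjugate
        g≡h : g ≡ h
        g≡h = ∙-cancelˡ (t · g) g h (begin
          (t · g) · g           ≡⟨ fix₂ ⟨
          τ ((t · g) · g)       ≡⟨ cong (λ u → τ (u · g)) fix₁ ⟨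
          τ (τ (t · g) · g)     ≡⟨ τ-conj (t · g) ⟩
          (t · g) · h           ∎)
        t·g≡g : t · g ≡ g
        t·g≡g = begin
          t · g                 ≡⟨ fix₁ ⟨
          τ (t · g)             ≡⟨ cong (λ u → τ (u · g)) (transpose-x one t) ⟨
          τ (τ one · g)         ≡⟨ τ-conj one ⟩
          one · h               ≡⟨ identityˡ h ⟩
          h                     ≡⟨ g≡h ⟨
          g                     ∎

module Modular (n : ℕ) .{{_ : NonZero n}} where

  infix 4 _≈_
  record _≈_ (x y : ℤ) : Set where
    constructor congruent
    field n∣x-y : + n ∣ x - y

  ≈-reflexive : ∀ {x y} → x ≡ y → x ≈ y
  ≈-reflexive {x} refl = congruent (subst (+ n ∣_) (sym (ℤₚ.+-inverseʳ x)) (divides (+ 0) refl))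

  ≈-refl : ∀ {x} → x ≈ x
  ≈-refl = ≈-reflexive refl

  ≈-sym : ∀ {x y} → x ≈ y → y ≈ x
  ≈-sym {x} {y} (congruent p) = congruent (subst (+ n ∣_) (negate x y) (∣m⇒∣-m p))
    where negate : ∀ x y → - (x - y) ≡ y - x
          negate = solve-∀

  ≈-trans : ∀ {x y z} → x ≈ y → y ≈ z → x ≈ z
  ≈-trans {x} {y} {z} (congruent p) (congruent q) =
    congruent (subst (+ n ∣_) (telescope x y z) (∣m∣n⇒∣m+n p q))
    where telescope : ∀ x y z → (x - y) + (y - z) ≡ x - z
          telescope = solve-∀

  ≈-setoid : Setoid _ _
  ≈-setoid = record
    { Carrier = ℤ ; _≈_ = _≈_
    ; isEquivalence = record { refl = ≈-reflexive refl ; sym = ≈-sym ; trans = ≈-trans } }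

  +-cong : ∀ {x y u v} → x ≈ y → u ≈ v → x + u ≈ y + v
  +-cong {x} {y} {u} {v} (congruent p) (congruent q) =
    congruent (subst (+ n ∣_) (regroup x y u v) (∣m∣n⇒∣m+n p q))
    where regroup : ∀ x y u v → (x - y) + (u - v) ≡ (x + u) - (y + v)
          regroup = solve-∀

  neg-cong : ∀ {x y} → x ≈ y → - x ≈ - y
  neg-cong {x} {y} (congruent p) = congruent (subst (+ n ∣_) (regroup x y) (∣m⇒∣-m p))
    where regroup : ∀ x y → - (x - y) ≡ - x - - y
          regroup = solve-∀

  *-cong : ∀ {x y u v} → x ≈ y → u ≈ v → x * u ≈ y * v
  *-cong {x} {y} {u} {v} (congruent p) (congruent q) =
    congruent (subst (+ n ∣_) (regroup x y u v) (∣m∣n⇒∣m+n (∣m⇒∣m*n u p) (∣n⇒∣m*n y q)))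
    where regroup : ∀ x y u v → (x - y) * u + y * (u - v) ≡ x * u - y * v
          regroup = solve-∀

  +-congˡ : ∀ c {x y} → x ≈ y → c + x ≈ c + y
  +-congˡ c = +-cong (≈-refl {c})

  *-congˡ : ∀ c {x y} → x ≈ y → c * x ≈ c * y
  *-congˡ c = *-cong (≈-refl {c})

  *-congʳ : ∀ c {x y} → x ≈ y → x * c ≈ y * c
  *-congʳ c x≈y = *-cong x≈y (≈-refl {c})

  multiple≈0 : ∀ x → x * + n ≈ + 0
  multiple≈0 x = congruent (divides x (ℤₚ.+-identityʳ (x * + n)))

  cancel-+ˡ : ∀ c x {d} → c + x ≈ d → x ≈ d - c
  cancel-+ˡ c x c+x≈d = ≈-trans (≈-reflexive (cancel c x)) (+-cong c+x≈d (≈-refl { - c }))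
    where cancel : ∀ c x → x ≡ (c + x) - c
          cancel = solve-∀

  ⟦_⟧ : Fin n → ℤ
  ⟦ i ⟧ = + toℕ i

  reduce : ℤ → Fin n
  reduce z = fromℕ< (n%ℕd<d z n)

  ⟦reduce⟧ : ∀ z → ⟦ reduce z ⟧ ≈ z
  ⟦reduce⟧ z = congruent (divides (- (z /ℕ n)) (begin
    ⟦ reduce z ⟧ - z                             ≡⟨ cong₂ _-_ (cong +_ (Finₚ.toℕ-fromℕ< _))
                                                              (a≡a%ℕn+[a/ℕn]*n z n) ⟩
    + (z %ℕ n) - (+ (z %ℕ n) + (z /ℕ n) * + n)   ≡⟨ cancel (+ (z %ℕ n)) (z /ℕ n) (+ n) ⟩
    - (z /ℕ n) * + n                             ∎))
    where
    open ≡-Reasoning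
    cancel : ∀ r q m → r - (r + q * m) ≡ - q * m
    cancel = solve-∀

  private
    multiple-below-is-zero : ∀ {d} → n ∣ℕ d → d ℕ.< n → d ≡ 0
    multiple-below-is-zero {ℕ.zero}  _   _   = refl
    multiple-below-is-zero {ℕ.suc d} n∣d d<n = ⊥-elim (ℕₚ.<⇒≱ d<n (∣⇒≤ n∣d))

  ⟦⟧-injective : ∀ {i j} → ⟦ i ⟧ ≈ ⟦ j ⟧ → i ≡ j
  ⟦⟧-injective {i} {j} (congruent n∣i-j) =
    Finₚ.toℕ-injective (ℤₚ.+-injective (ℤₚ.i-j≡0⇒i≡j _ _ (ℤₚ.∣i∣≡0⇒i≡0 ∣i-j∣≡0)))
    where
    below : ∣ ⟦ i ⟧ - ⟦ j ⟧ ∣ ℕ.< n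
    below = subst (ℕ._< n) (cong ∣_∣ (sym (ℤₚ.[+m]-[+n]≡m⊖n (toℕ i) (toℕ j))))
              (ℕₚ.≤-<-trans (ℤₚ.∣m⊝n∣≤m⊔n (toℕ i) (toℕ j))
                            (ℕₚ.⊔-lub (Finₚ.toℕ<n i) (Finₚ.toℕ<n j)))
    ∣i-j∣≡0 : ∣ ⟦ i ⟧ - ⟦ j ⟧ ∣ ≡ 0
    ∣i-j∣≡0 = multiple-below-is-zero (∣⇒∣ᵤ n∣i-j) below

  reduce-unique : ∀ {i z} → ⟦ i ⟧ ≈ z → reduce z ≡ i
  reduce-unique {i} {z} p = ⟦⟧-injective (≈-trans (⟦reduce⟧ z) (≈-sym p))

  reduce-injective : ∀ {x y} → reduce x ≡ reduce y → x ≈ y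
  reduce-injective {x} {y} eq =
    ≈-trans (≈-sym (⟦reduce⟧ x)) (≈-trans (≈-reflexive (cong ⟦_⟧ eq)) (⟦reduce⟧ y))

  ⟦mod⟧ : ∀ m → ⟦ m mod n ⟧ ≈ + m
  ⟦mod⟧ m = subst (_≈ + m) (cong ⟦_⟧ (Finₚ.fromℕ<-cong _ _ refl _ _)) (⟦reduce⟧ (+ m))

  ⟦addₙ⟧ : ∀ i j → ⟦ addₙ n i j ⟧ ≈ ⟦ i ⟧ + ⟦ j ⟧
  ⟦addₙ⟧ i j = ⟦mod⟧ (toℕ i ℕ.+ toℕ j)

  ⟦negₙ⟧ : ∀ i → ⟦ negₙ n i ⟧ ≈ - ⟦ i ⟧
  ⟦negₙ⟧ i = ≈-trans (⟦mod⟧ (n ℕ.∸ toℕ i)) (congruent (divides (+ 1) (begin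
    + (n ℕ.∸ toℕ i) - - ⟦ i ⟧     ≡⟨ cong (_- - ⟦ i ⟧) n∸i≡n-i ⟨
    (+ n - ⟦ i ⟧) - - ⟦ i ⟧       ≡⟨ cancel (+ n) ⟦ i ⟧ ⟩
    + 1 * + n                     ∎)))
    where
    open ≡-Reasoning
    n∸i≡n-i : + n - ⟦ i ⟧ ≡ + (n ℕ.∸ toℕ i)
    n∸i≡n-i = trans (ℤₚ.m-n≡m⊖n n (toℕ i)) (ℤₚ.⊖-≥ (ℕₚ.<⇒≤ (Finₚ.toℕ<n i)))
    cancel : ∀ m j → (m - j) - - j ≡ + 1 * m
    cancel = solve-∀

-- The infinite dihedral group ℤ ⋊ C₂; (x , e) stands for a^x b^e as in Dih n.
D∞ : Set
D∞ = ℤ × Bool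

infixl 7 _∙_
_∙_ : D∞ → D∞ → D∞
(x , false) ∙ (y , f) = x + y , f
(x , true)  ∙ (y , f) = x - y , not f

infix 8 _⁻¹
_⁻¹ : D∞ → D∞
(x , false) ⁻¹ = - x , false
(x , true)  ⁻¹ = x , true

1∞ : D∞
1∞ = + 0 , false

D∞-isGroup : IsGroup _≡_ _∙_ 1∞ _⁻¹
D∞-isGroup = record
  { isMonoid = record
    { isSemigroup = record
      { isMagma = record { isEquivalence = isEquivalence ; ∙-cong = cong₂ _∙_ }
      ; assoc = assoc }
    ; identity = identityˡ , identityʳ }
  ; inverse = inverseˡ , inverseʳ
  ; ⁻¹-cong = cong _⁻¹ }
  where
  sub-sub : ∀ x y z → (x - y) - z ≡ x - (y + z)
  sub-sub = solve-∀
  sub-add : ∀ x y z → (x - y) + z ≡ x - (y - z)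
  sub-add = solve-∀

  assoc : ∀ u v w → (u ∙ v) ∙ w ≡ u ∙ (v ∙ w)
  assoc (x , false) (y , false) (z , e)     = cong (_, e) (ℤₚ.+-assoc x y z)
  assoc (x , false) (y , true)  (z , e)     = cong (_, not e) (ℤₚ.+-assoc x y (- z))
  assoc (x , true)  (y , false) (z , e)     = cong (_, not e) (sub-sub x y z)
  assoc (x , true)  (y , true)  (z , false) = cong (_, false) (sub-add x y z)
  assoc (x , true)  (y , true)  (z , true)  = cong (_, true) (sub-add x y z)

  identityˡ : ∀ u → 1∞ ∙ u ≡ u
  identityˡ (x , e) = cong (_, e) (ℤₚ.+-identityˡ x)

  identityʳ : ∀ u → u ∙ 1∞ ≡ u
  identityʳ (x , false) = cong (_, false) (ℤₚ.+-identityʳ x)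
  identityʳ (x , true)  = cong (_, true) (ℤₚ.+-identityʳ x)

  inverseˡ : ∀ u → u ⁻¹ ∙ u ≡ 1∞
  inverseˡ (x , false) = cong (_, false) (ℤₚ.+-inverseˡ x)
  inverseˡ (x , true)  = cong (_, false) (ℤₚ.+-inverseʳ x)

  inverseʳ : ∀ u → u ∙ u ⁻¹ ≡ 1∞
  inverseʳ (x , false) = cong (_, false) (ℤₚ.+-inverseʳ x)
  inverseʳ (x , true)  = cong (_, false) (ℤₚ.+-inverseʳ x)

-- the endomorphism a ↦ a^i, b ↦ a^c b
affine∞ : ℤ → ℤ → D∞ → D∞
affine∞ i c (x , false) = i * x , false
affine∞ i c (x , true)  = i * x + c , true

affine∞-∙ : ∀ i c u v → affine∞ i c (u ∙ v) ≡ affine∞ i c u ∙ affine∞ i c v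
affine∞-∙ i c (x , false) (y , false) = cong (_, false) (ℤₚ.*-distribˡ-+ i x y)
affine∞-∙ i c (x , false) (y , true)  = cong (_, true) (expand i c x y)
  where expand : ∀ i c x y → i * (x + y) + c ≡ i * x + (i * y + c)
        expand = solve-∀
affine∞-∙ i c (x , true)  (y , false) = cong (_, true) (expand i c x y)
  where expand : ∀ i c x y → i * (x - y) + c ≡ (i * x + c) - i * y
        expand = solve-∀
affine∞-∙ i c (x , true)  (y , true)  = cong (_, false) (expand i c x y)
  where expand : ∀ i c x y → i * (x - y) ≡ (i * x + c) - (i * y + c)
        expand = solve-∀

affine∞-∘ : ∀ i c m d u → affine∞ i c (affine∞ m d u) ≡ affine∞ (i * m) (i * d + c) u
affine∞-∘ i c m d (x , false) = cong (_, false) (sym (ℤₚ.*-assoc i m x))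
affine∞-∘ i c m d (x , true)  = cong (_, true) (compose i c m d x)
  where compose : ∀ i c m d x → i * (m * x + d) + c ≡ i * m * x + (i * d + c)
        compose = solve-∀

module Dihedral (n : ℕ) .{{_ : NonZero n}} where

  open Modular n public
  open GroupOn (D n) public

  _≟_ : DecidableEquality (Dih n)
  _≟_ = _≟D_ n

  π : D∞ → Dih n
  π (x , e) = reduce x , e

  lift : Dih n → D∞
  lift (i , e) = ⟦ i ⟧ , e

  infix 4 _≋_
  record _≋_ (u v : D∞) : Set where
    constructor _,_
    field
      exponent≈ : proj₁ u ≈ proj₁ v
      parity≡   : proj₂ u ≡ proj₂ v
  open _≋_ public

  π-lift : ∀ x → π (lift x) ≡ x
  π-lift (i , e) = cong (_, e) (reduce-unique (≈-reflexive refl))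

  lift-π : ∀ u → lift (π u) ≋ u
  lift-π (x , e) = ⟦reduce⟧ x , refl

  π-cong : ∀ {u v} → u ≋ v → π u ≡ π v
  π-cong {x , e} {y , .e} (x≈y , refl) = cong (_, e) (reduce-unique (≈-trans (⟦reduce⟧ y) (≈-sym x≈y)))

  π-injective : ∀ u v → π u ≡ π v → u ≋ v
  π-injective (x , e) (y , f) eq = reduce-injective (cong proj₁ eq) , cong proj₂ eq

  π-∙ : ∀ u v → π (u ∙ v) ≡ π u · π v
  π-∙ (x , false) (y , f) = cong (_, f) (reduce-unique (≈-trans (⟦addₙ⟧ (reduce x) (reduce y))
                                                                 (+-cong (⟦reduce⟧ x) (⟦reduce⟧ y))))
  π-∙ (x , true)  (y , f) = cong (_, not f) (reduce-unique (≈-trans (⟦addₙ⟧ (reduce x) (negₙ n (reduce y)))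
                                                                     (+-cong (⟦reduce⟧ x) ⟦-y⟧)))
    where ⟦-y⟧ : ⟦ negₙ n (reduce y) ⟧ ≈ - y
          ⟦-y⟧ = ≈-trans (⟦negₙ⟧ (reduce y)) (neg-cong (⟦reduce⟧ y))

  π-⁻¹ : ∀ u → π (u ⁻¹) ≡ inv (π u)
  π-⁻¹ (x , false) = cong (_, false) (reduce-unique (≈-trans (⟦negₙ⟧ (reduce x)) (neg-cong (⟦reduce⟧ x))))
  π-⁻¹ (x , true)  = refl

  π-mod : ∀ m e → π (+ m , e) ≡ (m mod n , e)
  π-mod m e = cong (_, e) (Finₚ.fromℕ<-cong _ _ refl _ _)

  isGroup : IsGroupOn (D n)
  isGroup = surjective-image-isGroup D∞-isGroup (D n) π lift π-lift π-∙ (π-mod 0 false) π-⁻¹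

  open CayleyDigraph (D n) isGroup public
  open IsGroup isGroup using (assoc; identityʳ; inverseʳ)
  open GroupProperties group using (⁻¹-involutive)

  affine∞-cong : ∀ i c {u v} → u ≋ v → affine∞ i c u ≋ affine∞ i c v
  affine∞-cong i c {x , false} {y , .false} (x≈y , refl) = *-congˡ i x≈y , refl
  affine∞-cong i c {x , true}  {y , .true}  (x≈y , refl) = +-cong (*-congˡ i x≈y) ≈-refl , refl

  affine∞-≋-id : ∀ {i c} → i ≈ + 1 → c ≈ + 0 → ∀ u → affine∞ i c u ≋ u
  affine∞-≋-id i≈1 c≈0 (x , false) =
    ≈-trans (*-congʳ x i≈1) (≈-reflexive (ℤₚ.*-identityˡ x)) , refl
  affine∞-≋-id i≈1 c≈0 (x , true)  =
    ≈-trans (+-cong (*-congʳ x i≈1) c≈0)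
            (≈-reflexive (trans (ℤₚ.+-identityʳ (+ 1 * x)) (ℤₚ.*-identityˡ x))) , refl

  affine : ℤ → ℤ → Dih n → Dih n
  affine i c x = π (affine∞ i c (lift x))

  affine-π : ∀ i c u → affine i c (π u) ≡ π (affine∞ i c u)
  affine-π i c u = π-cong (affine∞-cong i c (lift-π u))

  affine-· : ∀ i c x y → affine i c (x · y) ≡ affine i c x · affine i c y
  affine-· i c x y = begin
    affine i c (x · y)                           ≡⟨ cong (affine i c) (cong₂ _·_ (π-lift x) (π-lift y)) ⟨
    affine i c (π X · π Y)                       ≡⟨ cong (affine i c) (π-∙ X Y) ⟨
    affine i c (π (X ∙ Y))                       ≡⟨ affine-π i c (X ∙ Y) ⟩
    π (affine∞ i c (X ∙ Y))                      ≡⟨ cong π (affine∞-∙ i c X Y) ⟩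
    π (affine∞ i c X ∙ affine∞ i c Y)            ≡⟨ π-∙ (affine∞ i c X) (affine∞ i c Y) ⟩
    affine i c x · affine i c y                  ∎
    where
    open ≡-Reasoning
    X Y : D∞
    X = lift x
    Y = lift y

  affine-∘-id : ∀ {i c m d} → i * m ≈ + 1 → i * d + c ≈ + 0 → ∀ x → affine i c (affine m d x) ≡ x
  affine-∘-id {i} {c} {m} {d} im≈1 id+c≈0 x = begin
    affine i c (affine m d x)                    ≡⟨ affine-π i c (affine∞ m d (lift x)) ⟩
    π (affine∞ i c (affine∞ m d (lift x)))       ≡⟨ cong π (affine∞-∘ i c m d (lift x)) ⟩
    π (affine∞ (i * m) (i * d + c) (lift x))     ≡⟨ π-cong (affine∞-≋-id im≈1 id+c≈0 (lift x)) ⟩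
    π (lift x)                                   ≡⟨ π-lift x ⟩
    x                                            ∎
    where open ≡-Reasoning

  affine-↔ : ∀ {i m} → i * m ≈ + 1 → ℤ → Dih n ↔ Dih n
  affine-↔ {i} {m} im≈1 c =
    mk↔ₛ′ (affine i c) (affine m (- (m * c))) (affine-∘-id im≈1 i[-mc]+c≈0) (affine-∘-id mi≈1 mc-mc≈0)
    where
    mi≈1 : m * i ≈ + 1
    mi≈1 = subst (_≈ + 1) (ℤₚ.*-comm i m) im≈1
    mc-mc≈0 : m * c + - (m * c) ≈ + 0
    mc-mc≈0 = ≈-reflexive (ℤₚ.+-inverseʳ (m * c))
    i[-mc]+c≈0 : i * - (m * c) + c ≈ + 0
    i[-mc]+c≈0 = begin
      i * - (m * c) + c       ≡⟨ regroup i m c ⟩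
      (+ 1 - i * m) * c       ≈⟨ *-congʳ c (+-congˡ (+ 1) (neg-cong im≈1)) ⟩
      (+ 1 - + 1) * c         ≡⟨⟩
      + 0                     ∎
      where
      open SetoidReasoning ≈-setoid
      regroup : ∀ i m c → i * - (m * c) + c ≡ (+ 1 - i * m) * c
      regroup = solve-∀

  a∈image-affine⇒unit : ∀ {i c} y → affine i c y ≡ π (+ 1 , false) → Σ ℤ λ m → i * m ≈ + 1
  a∈image-affine⇒unit {i} (j , false) eq =
    ⟦ j ⟧ , exponent≈ (π-injective (i * ⟦ j ⟧ , false) (+ 1 , false) eq)
  a∈image-affine⇒unit (j , true) ()

  listSubset⇒∈ : ∀ xs x → listSubset n xs x ≡ true → x ∈ xs
  listSubset⇒∈ (s ∷ xs) x x∈xs with x ≟ s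
  ... | yes x≡s = here x≡s
  ... | no  _   = there (listSubset⇒∈ xs x x∈xs)

  ∈⇒listSubset : ∀ xs x → x ∈ xs → listSubset n xs x ≡ true
  ∈⇒listSubset (s ∷ _) x (here x≡s) with x ≟ s
  ... | yes _   = refl
  ... | no  x≢s = ⊥-elim (x≢s x≡s)
  ∈⇒listSubset (s ∷ xs) x (there x∈xs) with x ≟ s
  ... | yes _ = refl
  ... | no  _ = ∈⇒listSubset xs x x∈xs

  rotation≢reflection : ∀ {i j : Fin n} → _≢_ {A = Dih n} (i , false) (j , true)
  rotation≢reflection ()

  reflection≢rotation : ∀ {i j : Fin n} → _≢_ {A = Dih n} (i , true) (j , false)
  reflection≢rotation ()

  ab : Dih n
  ab = a n · b n

  π-product : ∀ {x y} u v → x ≡ π u → y ≡ π v → x · y ≡ π (u ∙ v)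
  π-product u v refl refl = sym (π-∙ u v)

  a≡π : a n ≡ π (+ 1 , false)
  a≡π = sym (π-mod 1 false)

  a⁻¹≡π : a⁻¹ n ≡ π (- + 1 , false)
  a⁻¹≡π = trans (cong inv a≡π) (sym (π-⁻¹ (+ 1 , false)))

  a²b≡π : a²b n ≡ π (+ 2 , true)
  a²b≡π = sym (π-mod 2 true)

  b≡π : b n ≡ π (+ 0 , true)
  b≡π = sym (π-mod 0 true)

  ab≡π : ab ≡ π (+ 1 , true)
  ab≡π = π-product (+ 1 , false) (+ 0 , true) a≡π b≡π

  a²b≡a·ab : a²b n ≡ a n · ab
  a²b≡a·ab = trans a²b≡π (sym (π-product (+ 1 , false) (+ 1 , true) a≡π ab≡π))

  b≡a⁻¹·ab : b n ≡ a⁻¹ n · ab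
  b≡a⁻¹·ab = trans b≡π (sym (π-product (- + 1 , false) (+ 1 , true) a⁻¹≡π ab≡π))

  S₀-list : List (Dih n)
  S₀-list = a n ∷ a⁻¹ n ∷ a²b n ∷ b n ∷ []

  S : Subset (Dih n)
  S = S₀ n

  S⇒∈ : ∀ x → S x ≡ true → x ∈ S₀-list
  S⇒∈ = listSubset⇒∈ S₀-list

  ∈⇒S : ∀ x → x ∈ S₀-list → S x ≡ true
  ∈⇒S = ∈⇒listSubset S₀-list

  rotation∈S : ∀ {z} → S (π (z , false)) ≡ true → z ≈ + 1 ⊎ z ≈ - + 1
  rotation∈S {z} z∈S with S⇒∈ (π (z , false)) z∈S
  ... | here eq                        = inj₁ (exponent≈ (π-injective (z , false) (+ 1 , false) (trans eq a≡π)))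
  ... | there (here eq)                = inj₂ (exponent≈ (π-injective (z , false) (- + 1 , false) (trans eq a⁻¹≡π)))
  ... | there (there (here ()))
  ... | there (there (there (here ())))

  reflection∈S : ∀ {z} → S (π (z , true)) ≡ true → z ≈ + 2 ⊎ z ≈ + 0
  reflection∈S {z} z∈S with S⇒∈ (π (z , true)) z∈S
  ... | here ()
  ... | there (here ())
  ... | there (there (here eq))        = inj₁ (exponent≈ (π-injective (z , true) (+ 2 , true) (trans eq a²b≡π)))
  ... | there (there (there (here eq))) = inj₂ (exponent≈ (π-injective (z , true) (+ 0 , true) (trans eq b≡π)))

  S-symmetric : Symmetric S
  S-symmetric = involution-invariant S inv ⁻¹-involutive inv-closed
    where
    inv-closed : ∀ x → S x ≡ true → S (inv x) ≡ true
    inv-closed x x∈S with S⇒∈ x x∈S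
    ... | here refl                         = ∈⇒S (inv x) (there (here refl))
    ... | there (here refl)                 = ∈⇒S (inv x) (here (⁻¹-involutive (a n)))
    ... | there (there (here refl))         = ∈⇒S (inv x) (there (there (here refl)))
    ... | there (there (there (here refl))) = ∈⇒S (inv x) (there (there (there (here refl))))

  ab-twin : Twins S one ab
  ab-twin = Twins-one⁺ {S = S} {t = ab} (involution-invariant S (_· ab) ·ab·ab ·ab-closed)
    where
    ·ab·ab : ∀ x → (x · ab) · ab ≡ x
    ·ab·ab x = trans (assoc x ab ab) (trans (cong (x ·_) (inverseʳ ab)) (identityʳ x))
    a²b·ab≡a : a²b n · ab ≡ a n
    a²b·ab≡a = trans (π-product (+ 2 , true) (+ 1 , true) a²b≡π ab≡π) (sym a≡π)
    b·ab≡a⁻¹ : b n · ab ≡ a⁻¹ n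
    b·ab≡a⁻¹ = trans (π-product (+ 0 , true) (+ 1 , true) b≡π ab≡π) (sym a⁻¹≡π)
    ·ab-closed : ∀ x → S x ≡ true → S (x · ab) ≡ true
    ·ab-closed x x∈S with S⇒∈ x x∈S
    ... | here refl                         = ∈⇒S (x · ab) (there (there (here (sym a²b≡a·ab))))
    ... | there (here refl)                 = ∈⇒S (x · ab) (there (there (there (here (sym b≡a⁻¹·ab)))))
    ... | there (there (here refl))         = ∈⇒S (x · ab) (here a²b·ab≡a)
    ... | there (there (there (here refl))) = ∈⇒S (x · ab) (there (here b·ab≡a⁻¹))

  S-connected : Connected (D n) S
  S-connected = connected-from-one {S = S} λ z →
    subst (Star (Arc (D n) S) one) (π-lift z) (reaches (toℕ (proj₁ z)) (proj₂ z))
    where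
    reaches : ∀ m e → Star (Arc (D n) S) one (π (+ m , e))
    reaches ℕ.zero    false = subst (Star (Arc (D n) S) one) (sym (π-mod 0 false)) ε
    reaches ℕ.zero    true  = subst (Arc (D n) S one) (trans (identityʳ (b n)) b≡π)
                                (arc-left {S = S} one (b n) (∈⇒S (b n) b∈S₀)) ◅ ε
      where
      b∈S₀ : b n ∈ S₀-list
      b∈S₀ = there (there (there (here refl)))
    reaches (ℕ.suc m) e     = reaches m e ◅◅ (step ◅ ε)
      where
      step : Arc (D n) S (π (+ m , e)) (π (+ ℕ.suc m , e))
      step = subst (Arc (D n) S (π (+ m , e))) (π-product (+ 1 , false) (+ m , e) a≡π refl)
               (arc-left {S = S} (π (+ m , e)) (a n) (∈⇒S (a n) (here refl)))

module OddDihedral (n : ℕ) .{{_ : NonZero n}} (3≤n : 3 ≤ n) (odd : Odd n) where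

  open Dihedral n
  open Transposition _≟_
  open IsGroup isGroup using (inverseʳ)
  open GroupProperties group using (ε⁻¹≈ε; ⁻¹-involutive; ∙-cancelʳ; identityʳ-unique; inverseˡ-unique)

  1≉0 : ¬ (+ 1 ≈ + 0)
  1≉0 (congruent n∣1) = ℕₚ.<⇒≱ 3≤n (ℕₚ.≤-trans (∣⇒≤ (∣⇒∣ᵤ n∣1)) (ℕₚ.n≤1+n 1))

  -- 2 is invertible modulo n = 2k + 1, with inverse k + 1
  halve : ∀ x → x + x ≈ + 0 → x ≈ + 0
  halve x 2x≈0 = begin
    x                                    ≡⟨ expand x ⟩
    (+ k + + 1) * (x + x) - x * + n      ≈⟨ +-cong (*-congˡ (+ k + + 1) 2x≈0) (neg-cong (multiple≈0 x)) ⟩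
    (+ k + + 1) * + 0 - + 0              ≡⟨ trans (ℤₚ.+-identityʳ _) (ℤₚ.*-zeroʳ (+ k + + 1)) ⟩
    + 0                                  ∎
    where
    open SetoidReasoning ≈-setoid
    k : ℕ
    k = proj₁ odd
    n≡1+2k : + n ≡ + 1 + + 2 * + k
    n≡1+2k = trans (cong +_ (proj₂ odd)) (cong (λ m → + 1 + m) (ℤₚ.pos-* 2 k))
    expand : ∀ x → x ≡ (+ k + + 1) * (x + x) - x * + n
    expand x = subst (λ N → x ≡ (+ k + + 1) * (x + x) - x * N) (sym n≡1+2k) (identity x (+ k))
      where identity : ∀ x k → x ≡ (k + + 1) * (x + x) - x * (+ 1 + + 2 * k)
            identity = solve-∀

  2≉0 : ¬ (+ 2 ≈ + 0)
  2≉0 2≈0 = 1≉0 (halve (+ 1) 2≈0)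

  4≉0 : ¬ (+ 4 ≈ + 0)
  4≉0 4≈0 = 2≉0 (halve (+ 2) 4≈0)

  apart-by-4 : ∀ {x c} → x ≈ c → ¬ (x ≈ c + + 4)
  apart-by-4 {x} {c} x≈c x≈c+4 =
    4≉0 (≈-trans (cancel-+ˡ c (+ 4) (≈-trans (≈-sym x≈c+4) x≈c)) (≈-reflexive (ℤₚ.+-inverseʳ c)))

  common-neighbours : ∀ U → S (π ((+ 1 , false) ∙ U)) ≡ true → S (π ((- + 1 , false) ∙ U)) ≡ true →
                      U ≋ 1∞ ⊎ U ≋ (+ 1 , true)
  common-neighbours (x , false) a·U∈S a⁻¹·U∈S with rotation∈S a·U∈S | rotation∈S a⁻¹·U∈S
  ... | inj₁ 1+x≈1  | _            = inj₁ (cancel-+ˡ (+ 1) x 1+x≈1 , refl)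
  ... | inj₂ _      | inj₂ -1+x≈-1 = inj₁ (cancel-+ˡ (- + 1) x -1+x≈-1 , refl)
  ... | inj₂ 1+x≈-1 | inj₁ -1+x≈1  =
    ⊥-elim (apart-by-4 (cancel-+ˡ (+ 1) x 1+x≈-1) (cancel-+ˡ (- + 1) x -1+x≈1))
  common-neighbours (x , true) a·U∈S a⁻¹·U∈S with reflection∈S a·U∈S | reflection∈S a⁻¹·U∈S
  ... | inj₁ 1+x≈2  | _            = inj₂ (cancel-+ˡ (+ 1) x 1+x≈2 , refl)
  ... | inj₂ _      | inj₂ -1+x≈0  = inj₂ (cancel-+ˡ (- + 1) x -1+x≈0 , refl)
  ... | inj₂ 1+x≈0  | inj₁ -1+x≈2  =
    ⊥-elim (apart-by-4 (cancel-+ˡ (+ 1) x 1+x≈0) (cancel-+ˡ (- + 1) x -1+x≈2))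

  S-twins-of-one : ∀ {y} → Twins S one y → y ≡ one ⊎ y ≡ ab
  S-twins-of-one {y} tw =
    Sum.map (λ U≋1∞ → trans (y≡inv (trans inv-y≡πU (trans (π-cong U≋1∞) (π-mod 0 false)))) ε⁻¹≈ε)
            (λ U≋ab → y≡inv (trans inv-y≡πU (trans (π-cong U≋ab) (sym ab≡π))))
            (common-neighbours U (neighbour (+ 1) a≡π (here refl))
                                 (neighbour (- + 1) a⁻¹≡π (there (here refl))))
    where
    U : D∞
    U = lift (inv y)
    inv-y≡πU : inv y ≡ π U
    inv-y≡πU = sym (π-lift (inv y))
    neighbour : ∀ c {s} → s ≡ π (c , false) → s ∈ S₀-list → S (π ((c , false) ∙ U)) ≡ true
    neighbour c {s} s≡π s∈ = subst (λ z → S z ≡ true) (π-product (c , false) U s≡π inv-y≡πU)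
                                    (trans (Twins-one⁻ {S = S} tw s) (∈⇒S s s∈))
    y≡inv : ∀ {z} → inv y ≡ z → y ≡ inv z
    y≡inv eq = trans (sym (⁻¹-involutive y)) (cong inv eq)

  S-not-normal : ¬ IsNormalCayley (D n) S
  S-not-normal = transposition-not-normal S-symmetric ab-twin reflection≢rotation (a n)
                   reflection≢rotation ab·a≢ab reflection≢rotation ab·a·a≢ab
    where
    ab·a≡π : ab · a n ≡ π (+ 0 , true)
    ab·a≡π = π-product (+ 1 , true) (+ 1 , false) ab≡π a≡π
    ab·a·a≡π : (ab · a n) · a n ≡ π (- + 1 , true)
    ab·a·a≡π = π-product (+ 0 , true) (+ 1 , false) ab·a≡π a≡π
    reflection≡ab : ∀ x → π (x , true) ≡ ab → x ≈ + 1
    reflection≡ab x eq = exponent≈ (π-injective (x , true) (+ 1 , true) (trans eq ab≡π))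
    ab·a≢ab : ab · a n ≢ ab
    ab·a≢ab eq = 1≉0 (≈-sym (reflection≡ab (+ 0) (trans (sym ab·a≡π) eq)))
    ab·a·a≢ab : (ab · a n) · a n ≢ ab
    ab·a·a≢ab eq = 2≉0 (≈-sym (+-cong (reflection≡ab (- + 1) (trans (sym ab·a·a≡π) eq)) (≈-refl {+ 1})))

  involution⇒reflection : ∀ {x} → x · x ≡ one → x ≢ one → proj₂ x ≡ true
  involution⇒reflection {i , true}  _     _     = refl
  involution⇒reflection {i , false} xx≡one x≢one =
    ⊥-elim (x≢one (begin
      (i , false)          ≡⟨ x≡π ⟩
      π (⟦ i ⟧ , false)    ≡⟨ π-cong {⟦ i ⟧ , false} {1∞} (halve ⟦ i ⟧ 2i≈0 , refl) ⟩
      π 1∞                 ≡⟨ π-mod 0 false ⟩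
      one                  ∎))
    where
    open ≡-Reasoning
    x≡π : (i , false) ≡ π (⟦ i ⟧ , false)
    x≡π = sym (π-lift (i , false))
    2i≈0 : ⟦ i ⟧ + ⟦ i ⟧ ≈ + 0
    2i≈0 = exponent≈ (π-injective (⟦ i ⟧ + ⟦ i ⟧ , false) 1∞ (begin
      π (⟦ i ⟧ + ⟦ i ⟧ , false)   ≡⟨ π-product (⟦ i ⟧ , false) (⟦ i ⟧ , false) x≡π x≡π ⟨
      (i , false) · (i , false)   ≡⟨ xx≡one ⟩
      one                         ≡⟨ π-mod 0 false ⟨
      π 1∞                        ∎))

  module CI (T : Subset (Dih n)) (T-one : T one ≡ false)
            (ψ : Dih n ↔ Dih n) (ψ-iso : IsCayIso (D n) S T ψ) (ψ-one : Inverse.to ψ one ≡ one) where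

    open Inverse ψ using (to; from; strictlyInverseˡ; strictlyInverseʳ)
    open Isomorphism {S} {T} {ψ} ψ-iso

    T-image : ∀ x → T (to x) ≡ S x
    T-image = connection-set-image ψ-one

    T⊆ψ[S] : ∀ {z} → T z ≡ true → z ∈ map to S₀-list
    T⊆ψ[S] {z} z∈T = subst (_∈ map to S₀-list) (strictlyInverseˡ z) (∈-map⁺ to (S⇒∈ (from z) from-z∈S))
      where
      from-z∈S : S (from z) ≡ true
      from-z∈S = trans (sym (T-image (from z))) (trans (cong T (strictlyInverseˡ z)) z∈T)

    T-inv : ∀ {x} → T x ≡ true → T (inv x) ≡ true
    T-inv {x} x∈T = trans (Symmetric-transport ψ-one S-symmetric x) x∈T

    g : Dih n
    g = to ab

    g-twin : Twins T one g
    g-twin = Twins-one-transport ψ-one ab-twin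

    T-twins-of-one : ∀ {h} → Twins T one h → h ≡ one ⊎ h ≡ g
    T-twins-of-one {h} tw = Sum.map (λ h′≡one → trans h≡to-h′ (trans (cong to h′≡one) ψ-one))
                                    (λ h′≡ab → trans h≡to-h′ (cong to h′≡ab))
                                    (S-twins-of-one tw′)
      where
      h≡to-h′ : h ≡ to (from h)
      h≡to-h′ = sym (strictlyInverseˡ h)
      tw′ : Twins S one (from h)
      tw′ = Isomorphism.Twins-one-transport {T} {S} {↔-sym ψ} IsCayIso-sym (ψ⁻¹-one ψ-one) tw

    g≢one : g ≢ one
    g≢one g≡one = reflection≢rotation (begin
      ab              ≡⟨ strictlyInverseʳ ab ⟨
      from g          ≡⟨ cong from (trans g≡one (sym ψ-one)) ⟩
      from (to one)   ≡⟨ strictlyInverseʳ one ⟩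
      one             ∎)
      where open ≡-Reasoning

    g-involution : g · g ≡ one
    g-involution = Sum.[ id , (λ gg≡g → ⊥-elim (g≢one (identityʳ-unique g g gg≡g))) ]′
                     (T-twins-of-one (Twins-one-· g-twin g-twin))

    T-·g : ∀ {x} → T x ≡ true → T (x · g) ≡ true
    T-·g {x} x∈T = trans (cong (λ u → T (x · u)) g≡inv-g) (trans (Twins-one⁻ {S = T} g-twin x) x∈T)
      where
      g≡inv-g : g ≡ inv g
      g≡inv-g = inverseˡ-unique g g g-involution

    r : Fin n
    r = proj₁ g

    g≡ : g ≡ (r , true)
    g≡ = cong (r ,_) (involution⇒reflection g-involution g≢one)

    rotation-in-T : Σ (Fin n) λ p → T (p , false) ≡ true
    rotation-in-T = rotation (to (a n)) (trans (T-image (a n)) (∈⇒S (a n) (here refl)))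
      where
      rotation : ∀ t → T t ≡ true → Σ (Fin n) λ p → T (p , false) ≡ true
      rotation (p , false) t∈T = p , t∈T
      rotation (p , true)  t∈T =
        proj₁ ((p , true) · (r , true)) , trans (cong (λ u → T ((p , true) · u)) (sym g≡)) (T-·g t∈T)

    p : Fin n
    p = proj₁ rotation-in-T

    ρ : Dih n
    ρ = p , false

    ρ≢one : ρ ≢ one
    ρ≢one ρ≡one = case trans (sym (proj₂ rotation-in-T)) (trans (cong T ρ≡one) T-one) of λ ()

    -- the affine map sending a ↦ ρ and ab ↦ g
    σ : Dih n → Dih n
    σ = affine ⟦ p ⟧ (⟦ r ⟧ - ⟦ p ⟧)

    σ-· : ∀ x y → σ (x · y) ≡ σ x · σ y
    σ-· = affine-· ⟦ p ⟧ (⟦ r ⟧ - ⟦ p ⟧)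

    σ-a : σ (a n) ≡ ρ
    σ-a = trans (cong σ a≡π) (trans (affine-π ⟦ p ⟧ (⟦ r ⟧ - ⟦ p ⟧) (+ 1 , false))
            (trans (cong (λ z → π (z , false)) (ℤₚ.*-identityʳ ⟦ p ⟧)) (π-lift ρ)))

    σ-ab : σ ab ≡ g
    σ-ab = trans (cong σ ab≡π) (trans (affine-π ⟦ p ⟧ (⟦ r ⟧ - ⟦ p ⟧) (+ 1 , true))
             (trans (cong (λ z → π (z , true)) (cancel ⟦ p ⟧ ⟦ r ⟧)) (trans (π-lift (r , true)) (sym g≡))))
      where cancel : ∀ i j → i * + 1 + (j - i) ≡ j
            cancel = solve-∀

    σ-·ab : ∀ x → σ (x · ab) ≡ σ x · g
    σ-·ab x = trans (σ-· x ab) (cong (σ x ·_) σ-ab)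

    σ-a⁻¹ : σ (a⁻¹ n) ≡ inv (σ (a n))
    σ-a⁻¹ = homomorphism-inv σ-· (a n)

    ms : List (Dih n)
    ms = map σ S₀-list

    ms⊆T : All (λ z → T z ≡ true) ms
    ms⊆T = σa∈T ∷ σa⁻¹∈T
         ∷ trans (cong (λ u → T (σ u)) a²b≡a·ab) (·ab-in-T (a n) σa∈T)
         ∷ trans (cong (λ u → T (σ u)) b≡a⁻¹·ab) (·ab-in-T (a⁻¹ n) σa⁻¹∈T)
         ∷ []
      where
      σa∈T : T (σ (a n)) ≡ true
      σa∈T = trans (cong T σ-a) (proj₂ rotation-in-T)
      σa⁻¹∈T : T (σ (a⁻¹ n)) ≡ true
      σa⁻¹∈T = trans (cong T σ-a⁻¹) (T-inv σa∈T)
      ·ab-in-T : ∀ y → T (σ y) ≡ true → T (σ (y · ab)) ≡ true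
      ·ab-in-T y σy∈T = trans (cong T (σ-·ab y)) (T-·g σy∈T)

    σa≢σa⁻¹ : σ (a n) ≢ σ (a⁻¹ n)
    σa≢σa⁻¹ eq = case involution⇒reflection ρρ≡one ρ≢one of λ ()
      where
      ρ≡ρ⁻¹ : ρ ≡ inv ρ
      ρ≡ρ⁻¹ = trans (sym σ-a) (trans eq (trans σ-a⁻¹ (cong inv σ-a)))
      ρρ≡one : ρ · ρ ≡ one
      ρρ≡one = trans (cong (ρ ·_) ρ≡ρ⁻¹) (inverseʳ ρ)

    ms-unique : Unique ms
    ms-unique = (σa≢σa⁻¹ ∷ rotation≢reflection ∷ rotation≢reflection ∷ [])
              ∷ (rotation≢reflection ∷ rotation≢reflection ∷ [])
              ∷ (σa²b≢σb ∷ [])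
              ∷ []
              ∷ []
      where
      σa²b≢σb : σ (a²b n) ≢ σ (b n)
      σa²b≢σb eq = σa≢σa⁻¹ (∙-cancelʳ g (σ (a n)) (σ (a⁻¹ n)) (begin
        σ (a n) · g          ≡⟨ σ-·ab (a n) ⟨
        σ (a n · ab)         ≡⟨ cong σ a²b≡a·ab ⟨
        σ (a²b n)            ≡⟨ eq ⟩
        σ (b n)              ≡⟨ cong σ b≡a⁻¹·ab ⟩
        σ (a⁻¹ n · ab)       ≡⟨ σ-·ab (a⁻¹ n) ⟩
        σ (a⁻¹ n) · g        ∎))
        where open ≡-Reasoning

    T⊆ms : ∀ {z} → T z ≡ true → z ∈ ms
    T⊆ms = Unique-covers _≟_ ms-unique ℕₚ.≤-refl T⊆ψ[S] ms⊆T

    T⊆σ[S] : ∀ {z} → T z ≡ true → Σ (Dih n) λ s → s ∈ S₀-list × z ≡ σ s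
    T⊆σ[S] z∈T = ∈-map⁻ σ {xs = S₀-list} (T⊆ms z∈T)

    InImageσ : Dih n → Set
    InImageσ x = Σ (Dih n) λ y → x ≡ σ y

    image-σ-closed : ∀ {s x} → T s ≡ true → InImageσ x → InImageσ (s · x)
    image-σ-closed s∈T (y , x≡σy) =
      let (y′ , _ , s≡σy′) = T⊆σ[S] s∈T
      in y′ · y , trans (cong₂ _·_ s≡σy′ x≡σy) (sym (σ-· y′ y))

    -- Cay(G,T) is connected, so the subgroup σ(G) ⊇ T is everything
    a∈image-σ : InImageσ (a n)
    a∈image-σ = connected⇒generated {S = T} (Connected-transport S-connected) {InImageσ}
                  (one , sym (homomorphism-one σ-·)) image-σ-closed (a n)

    ⟦p⟧-invertible : Σ ℤ λ m → ⟦ p ⟧ * m ≈ + 1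
    ⟦p⟧-invertible = a∈image-affine⇒unit {⟦ p ⟧} {⟦ r ⟧ - ⟦ p ⟧} (proj₁ a∈image-σ)
                       (trans (sym (proj₂ a∈image-σ)) a≡π)

    σ↔ : Dih n ↔ Dih n
    σ↔ = affine-↔ {⟦ p ⟧} {proj₁ ⟦p⟧-invertible} (proj₂ ⟦p⟧-invertible) (⟦ r ⟧ - ⟦ p ⟧)

    σ-injective : ∀ {x y} → σ x ≡ σ y → x ≡ y
    σ-injective = Injection.injective (↔⇒↣ σ↔)

    σ-maps-S-to-T : ∀ x → T (σ x) ≡ S x
    σ-maps-S-to-T x = ≡true⇔⇒≡ σx∈T⇒x∈S (λ x∈S → All.lookup ms⊆T (∈-map⁺ σ (S⇒∈ x x∈S)))
      where
      σx∈T⇒x∈S : T (σ x) ≡ true → S x ≡ true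
      σx∈T⇒x∈S σx∈T =
        let (s , s∈S₀ , σx≡σs) = T⊆σ[S] σx∈T
        in ∈⇒S x (subst (_∈ S₀-list) (sym (σ-injective σx≡σs)) s∈S₀)

    automorphism : Σ (Dih n ↔ Dih n) λ σ → IsGroupAut (D n) σ × (∀ x → T (Inverse.to σ x) ≡ S x)
    automorphism = σ↔ , σ-· , σ-maps-S-to-T

  S-CI : IsCI (D n) S
  S-CI T T-one iso =
    let (ψ , ψ-iso , ψ-one) = CayIsomorphic-fixing-one {S} {T} iso
    in CI.automorphism T T-one ψ ψ-iso ψ-one

lemma3p2 : (n : ℕ) .{{_ : NonZero n}} → 3 ≤ n → Odd n →
    Connected (D n) (S₀ n) × IsCI (D n) (S₀ n) × ¬ IsNormalCayley (D n) (S₀ n)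
lemma3p2 n 3≤n odd = Dihedral.S-connected n , S-CI , S-not-normal
  where open OddDihedral n 3≤n odd
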